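{- Let $N=\{1,\ldots,n\}$ and let $v$ be an additive bi-capacity on $N$, i.e. there exist additive normalized capacities $\nu_1,\nu_2$ on $N$ with $v(A,B)=\sum_{i\in A}\nu_1(\{i\})-\sum_{i\in B}\nu_2(\{i\})$ for all $(A,B)\in\mathcal{Q}(N)$. Then the M\"obius transform $m$ of $v$ is nonzero only on the join-irreducible elements of $\mathcal{Q}(N)$ (namely $(\{i\},N\setminus\{i\})$ and $(\emptyset,N\setminus\{i\})$, $i\in N$) and on the bottom element $(\emptyset,N)$; specifically \[ m(\{i\},N\setminus\{i\})=\nu_1(\{i\}),\quad m(\emptyset,N\setminus\{i\})=\nu_2(\{i\})\quad(\forall i\in N),\qquad m(\emptyset,N)=-1. \]
   Context: $\mathcal{Q}(N)=\{(A,B)\in 2^N\times 2^N : A\cap B=\emptyset\}$, ordered by $(A,B)\sqsubseteq(C,D)$ iff $A\subseteq C$ and $B\supseteq D$; it is a lattice with bottom $(\emptyset,N)$. A normalized capacity on $N$ is $\nu:2^N\to\mathbb{R}$ with $\nu(\emptyset)=0$, $\nu(N)=1$, monotone for inclusion; it is additive if $\nu(A)=\sum_{i\in A}\nu(\{i\})$. The M\"obius transform of $v:\mathcal{Q}(N)\to\mathbb{R}$ is the unique $m:\mathcal{Q}(N)\to\mathbb{R}$ with $v(A,A')=\sum_{(B,B')\sqsubseteq(A,A')}m(B,B')$ for all $(A,A')\in\mathcal{Q}(N)$.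
   Formalization: The additive capacities ν₁, ν₂, the bi-capacity v and its Möbius transform m take rational values rather than real ones. -}

module Defs where

open import Data.Nat using (ℕ; zero; suc)
open import Data.Bool using (Bool; true; false; if_then_else_)
import Data.Bool as Bool
open import Data.Fin using (Fin; zero; suc)
open import Data.Fin.Subset using (Subset; ⊥; ⊤; ⁅_⁆; ∁; _∩_; _⊆_; _⊇_; _∈_)
open import Data.Fin.Subset.Properties using (_⊆?_; _∈?_)
open import Data.Vec using ([]; _∷_)
open import Data.Vec.Properties using (≡-dec)
open import Data.Rational using (ℚ; 0ℚ; 1ℚ; _+_; _-_; _≤_)
open import Data.Product using (_×_)
open import Relation.Nullary using (Dec; ¬_)
open import Relation.Nullary.Decidable using (⌊_⌋; _×-dec_)
open import Relation.Binary.PropositionalEquality using (_≡_)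

sumFin : ∀ {n} → (Fin n → ℚ) → ℚ
sumFin {zero} f = 0ℚ
sumFin {suc n} f = f zero + sumFin (λ i → f (suc i))

sumIn : ∀ {n} → Subset n → (Fin n → ℚ) → ℚ
sumIn A f = sumFin (λ i → if ⌊ i ∈? A ⌋ then f i else 0ℚ)

sumSubsets : ∀ n → (Subset n → ℚ) → ℚ
sumSubsets zero f = f []
sumSubsets (suc n) f = sumSubsets n (λ s → f (false ∷ s)) + sumSubsets n (λ s → f (true ∷ s))

-- (A , B) ∈ Q(N) : A ∩ B = ∅
Disjoint : ∀ {n} → Subset n → Subset n → Set
Disjoint A B = A ∩ B ≡ ⊥

disjoint? : ∀ {n} (A B : Subset n) → Dec (Disjoint A B)
disjoint? A B = ≡-dec Bool._≟_ (A ∩ B) ⊥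

_⊑_ : ∀ {n} → (Subset n × Subset n) → (Subset n × Subset n) → Set
(A Data.Product., B) ⊑ (C Data.Product., D) = A ⊆ C × D ⊆ B

sumBelow : ∀ {n} → (Subset n → Subset n → ℚ) → Subset n → Subset n → ℚ
sumBelow {n} m A A' =
  sumSubsets n (λ B → sumSubsets n (λ B' →
    if ⌊ disjoint? B B' ×-dec (B ⊆? A ×-dec A' ⊆? B') ⌋ then m B B' else 0ℚ))

IsMobius : ∀ {n} → (Subset n → Subset n → ℚ) → (Subset n → Subset n → ℚ) → Set
IsMobius {n} v m = ∀ (A A' : Subset n) → Disjoint A A' → v A A' ≡ sumBelow m A A'

record IsNormalizedCapacity {n} (ν : Subset n → ℚ) : Set where
  field
    empty    : ν ⊥ ≡ 0ℚ
    full     : ν ⊤ ≡ 1ℚ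
    monotone : ∀ {A B} → A ⊆ B → ν A ≤ ν B

IsAdditive : ∀ {n} → (Subset n → ℚ) → Set
IsAdditive ν = ∀ A → ν A ≡ sumIn A (λ i → ν ⁅ i ⁆)

{-# OPTIONS --safe #-}
-- The Möbius transform on Q(N) is unique: if the sums of d over all disjoint pairs below each
-- disjoint pair vanish, then d vanishes on Q(N), by well-founded induction along the strict part
-- of ⊑. So it suffices to exhibit one transform of v. Put mass ν₁{i} at ({i}, N∖{i}), ν₂{i} at
-- (∅, N∖{i}) and -Σᵢ ν₂{i} at (∅, N); the pairs of the first kind below (A, A') are those with
-- i ∈ A, those of the second kind those with i ∉ A', so the sum below (A, A') is
-- Σ_A ν₁ + Σ_{N∖A'} ν₂ - Σ_N ν₂ = v(A, A'). Finally Σ_N ν₂{i} = ν₂(N) = 1; nothing else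
-- about the capacities is used.
module Submission where

open import Defs
open import Algebra.Bundles using (CommutativeMonoid)
open import Data.Bool using (true; false; if_then_else_)
import Data.Bool as Bool
open import Data.Bool.Properties using (if-eta; if-float)
open import Data.Fin using (Fin; zero; suc)
open import Data.Fin.Properties using (suc-injective)
open import Data.Fin.Subset using (Subset; ⊥; ⊤; ⁅_⁆; ∁; _⊆_; _⊂_; _⊃_; _∈_; inside; outside)
open import Data.Fin.Subset.Induction using (⊂-wellFounded; ⊃-wellFounded)
open import Data.Fin.Subset.Properties
open import Data.Nat using (ℕ; zero; suc)
open import Data.Product using (_×_; _,_; proj₁; proj₂; curry)
import Data.Product.Properties as Product
open import Data.Product.Relation.Binary.Lex.Strict using (×-Lex; ×-wellFounded)
open import Data.Rational using (ℚ; 0ℚ; 1ℚ; -_; _-_; _+_)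
import Data.Rational.Properties as ℚ
open import Data.Rational.Solver using (module +-*-Solver)
open import Data.Sum using (inj₁; inj₂)
open import Data.Vec using (_∷_; []; here)
open import Data.Vec.Properties using (≡-dec; ∷-injectiveʳ)
open import Function using (_∘_)
open import Function.Bundles using (_⇔_; mk⇔; Equivalence)
open import Induction.WellFounded using (WellFounded; Acc; acc)
open import Relation.Binary.Core using (Rel)
open import Relation.Binary.Definitions using (DecidableEquality)
open import Relation.Binary.PropositionalEquality
open import Relation.Nullary using (¬_; Dec; yes; no; contradiction)
open import Relation.Nullary.Decidable using (⌊_⌋; _×-dec_)

open import Algebra.Properties.Group ℚ.+-0-group using (x∙y⁻¹≈ε⇒x≈y)
open import Algebra.Properties.CommutativeSemigroup
  (CommutativeMonoid.commutativeSemigroup ℚ.+-0-commutativeMonoid) using (interchange)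
open +-*-Solver using (solve; _:+_; :-_; _:=_)

if-dec-yes : ∀ {p} {P : Set p} (P? : Dec P) → P → {x y : ℚ} → (if ⌊ P? ⌋ then x else y) ≡ x
if-dec-yes (yes _) _  = refl
if-dec-yes (no ¬p) p = contradiction p ¬p

if-dec-no : ∀ {p} {P : Set p} (P? : Dec P) → ¬ P → {x y : ℚ} → (if ⌊ P? ⌋ then x else y) ≡ y
if-dec-no (yes p) ¬p = contradiction p ¬p
if-dec-no (no _)  _  = refl

if-dec-⇔ : ∀ {p q} {P : Set p} {Q : Set q} (P? : Dec P) (Q? : Dec Q) → P ⇔ Q
         → {x y : ℚ} → (if ⌊ P? ⌋ then x else y) ≡ (if ⌊ Q? ⌋ then x else y)
if-dec-⇔ (yes p) Q? P⇔Q = sym (if-dec-yes Q? (Equivalence.to P⇔Q p))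
if-dec-⇔ (no ¬p) Q? P⇔Q = sym (if-dec-no Q? (¬p ∘ Equivalence.from P⇔Q))

if-+ : ∀ b (x y : ℚ) → (if b then x + y else 0ℚ) ≡ (if b then x else 0ℚ) + (if b then y else 0ℚ)
if-+ true  x y = refl
if-+ false x y = refl

sumFin-cong : ∀ {n} {f g : Fin n → ℚ} → (∀ i → f i ≡ g i) → sumFin f ≡ sumFin g
sumFin-cong {zero}  f≗g = refl
sumFin-cong {suc n} f≗g = cong₂ _+_ (f≗g zero) (sumFin-cong (f≗g ∘ suc))

sumFin-zero : ∀ {n} {f : Fin n → ℚ} → (∀ i → f i ≡ 0ℚ) → sumFin f ≡ 0ℚ
sumFin-zero {zero}  f≗0 = refl
sumFin-zero {suc n} f≗0 = cong₂ _+_ (f≗0 zero) (sumFin-zero (f≗0 ∘ suc))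

sumFin-+ : ∀ {n} (f g : Fin n → ℚ) → sumFin (λ i → f i + g i) ≡ sumFin f + sumFin g
sumFin-+ {zero}  f g = refl
sumFin-+ {suc n} f g = trans (cong (f zero + g zero +_) (sumFin-+ (f ∘ suc) (g ∘ suc)))
                             (interchange (f zero) (g zero) _ _)

sumFin-point : ∀ {n} (f : Fin n → ℚ) i → (∀ j → j ≢ i → f j ≡ 0ℚ) → sumFin f ≡ f i
sumFin-point f zero    f≡0 =
  trans (cong (f zero +_) (sumFin-zero (λ j → f≡0 (suc j) λ ()))) (ℚ.+-identityʳ (f zero))
sumFin-point f (suc i) f≡0 =
  trans (cong₂ _+_ (f≡0 zero λ ()) (sumFin-point (f ∘ suc) i (λ j j≢i → f≡0 (suc j) (j≢i ∘ suc-injective))))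
        (ℚ.+-identityˡ (f (suc i)))

sumSubsets-cong : ∀ n {f g : Subset n → ℚ} → (∀ s → f s ≡ g s) → sumSubsets n f ≡ sumSubsets n g
sumSubsets-cong zero    f≗g = f≗g []
sumSubsets-cong (suc n) f≗g =
  cong₂ _+_ (sumSubsets-cong n (f≗g ∘ (outside ∷_))) (sumSubsets-cong n (f≗g ∘ (inside ∷_)))

sumSubsets-zero : ∀ n {f : Subset n → ℚ} → (∀ s → f s ≡ 0ℚ) → sumSubsets n f ≡ 0ℚ
sumSubsets-zero zero    f≗0 = f≗0 []
sumSubsets-zero (suc n) f≗0 =
  cong₂ _+_ (sumSubsets-zero n (f≗0 ∘ (outside ∷_))) (sumSubsets-zero n (f≗0 ∘ (inside ∷_)))

sumSubsets-+ : ∀ n (f g : Subset n → ℚ) → sumSubsets n (λ s → f s + g s) ≡ sumSubsets n f + sumSubsets n g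
sumSubsets-+ zero    f g = refl
sumSubsets-+ (suc n) f g =
  trans (cong₂ _+_ (sumSubsets-+ n (f ∘ (outside ∷_)) (g ∘ (outside ∷_)))
                   (sumSubsets-+ n (f ∘ (inside ∷_)) (g ∘ (inside ∷_))))
        (interchange (sumSubsets n (f ∘ (outside ∷_))) (sumSubsets n (g ∘ (outside ∷_)))
                     (sumSubsets n (f ∘ (inside ∷_))) (sumSubsets n (g ∘ (inside ∷_))))

sumSubsets-neg : ∀ n (f : Subset n → ℚ) → sumSubsets n (λ s → - f s) ≡ - sumSubsets n f
sumSubsets-neg zero    f = refl
sumSubsets-neg (suc n) f =
  trans (cong₂ _+_ (sumSubsets-neg n (f ∘ (outside ∷_))) (sumSubsets-neg n (f ∘ (inside ∷_))))
        (sym (ℚ.neg-distrib-+ (sumSubsets n (f ∘ (outside ∷_))) (sumSubsets n (f ∘ (inside ∷_)))))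

sumSubsets-sumFin : ∀ n {m} (h : Subset n → Fin m → ℚ)
  → sumSubsets n (λ s → sumFin (h s)) ≡ sumFin (λ i → sumSubsets n (λ s → h s i))
sumSubsets-sumFin zero    h = refl
sumSubsets-sumFin (suc n) {m} h =
  trans (cong₂ _+_ (sumSubsets-sumFin n (h ∘ (outside ∷_))) (sumSubsets-sumFin n (h ∘ (inside ∷_))))
        (sym (sumFin-+ {m} _ _))

sumSubsets-point : ∀ n (f : Subset n → ℚ) s → (∀ t → t ≢ s → f t ≡ 0ℚ) → sumSubsets n f ≡ f s
sumSubsets-point zero    f [] f≡0 = refl
sumSubsets-point (suc n) f (outside ∷ s) f≡0 =
  trans (cong₂ _+_ (sumSubsets-point n (f ∘ (outside ∷_)) s (λ t t≢s → f≡0 _ (t≢s ∘ ∷-injectiveʳ)))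
                   (sumSubsets-zero n (λ t → f≡0 _ λ ())))
        (ℚ.+-identityʳ _)
sumSubsets-point (suc n) f (inside ∷ s) f≡0 =
  trans (cong₂ _+_ (sumSubsets-zero n (λ t → f≡0 _ λ ()))
                   (sumSubsets-point n (f ∘ (inside ∷_)) s (λ t t≢s → f≡0 _ (t≢s ∘ ∷-injectiveʳ))))
        (ℚ.+-identityˡ _)

sumSubsets²-point : ∀ n (g : Subset n → Subset n → ℚ) A A'
  → (∀ B B' → (B , B') ≢ (A , A') → g B B' ≡ 0ℚ)
  → sumSubsets n (λ B → sumSubsets n (g B)) ≡ g A A'
sumSubsets²-point n g A A' g≡0 =
  trans (sumSubsets-point n _ A (λ B B≢A → sumSubsets-zero n (λ B' → g≡0 B B' (B≢A ∘ cong proj₁))))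
        (sumSubsets-point n (g A) A' (λ B' B'≢A' → g≡0 A B' (B'≢A' ∘ cong proj₂)))

sumIn-⊤ : ∀ {n} (f : Fin n → ℚ) → sumIn ⊤ f ≡ sumFin f
sumIn-⊤ {n} f = sumFin-cong {n} (λ i → if-dec-yes (i ∈? ⊤) ∈⊤)

sumIn-∁ : ∀ {n} (A : Subset n) (f : Fin n → ℚ) → sumIn A f + sumIn (∁ A) f ≡ sumFin f
sumIn-∁ {n} A f = trans (sym (sumFin-+ {n} _ _)) (sumFin-cong split)
  where
  split : ∀ i → (if ⌊ i ∈? A ⌋ then f i else 0ℚ) + (if ⌊ i ∈? ∁ A ⌋ then f i else 0ℚ) ≡ f i
  split i with i ∈? A
  ... | yes i∈A = trans (cong (f i +_) (if-dec-no (i ∈? ∁ A) (x∈p⇒x∉∁p i∈A))) (ℚ.+-identityʳ (f i))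
  ... | no  i∉A = trans (cong (0ℚ +_) (if-dec-yes (i ∈? ∁ A) (x∉p⇒x∈∁p i∉A))) (ℚ.+-identityˡ (f i))

⊆∧≢⇒⊂ : ∀ {n} {p q : Subset n} → p ⊆ q → p ≢ q → p ⊂ q
⊆∧≢⇒⊂ {p = []}          {[]}          _   p≢q = contradiction refl p≢q
⊆∧≢⇒⊂ {p = outside ∷ p} {outside ∷ q} p⊆q p≢q = out⊂ (⊆∧≢⇒⊂ (drop-∷-⊆ p⊆q) (p≢q ∘ cong (outside ∷_)))
⊆∧≢⇒⊂ {p = outside ∷ p} {inside  ∷ q} p⊆q _   = out⊂in (drop-∷-⊆ p⊆q)
⊆∧≢⇒⊂ {p = inside  ∷ p} {outside ∷ q} p⊆q _   = contradiction (p⊆q here) λ ()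
⊆∧≢⇒⊂ {p = inside  ∷ p} {inside  ∷ q} p⊆q p≢q = in⊂in (⊆∧≢⇒⊂ (drop-∷-⊆ p⊆q) (p≢q ∘ cong (inside ∷_)))

⁅⁆-injective : ∀ {n} {i j : Fin n} → ⁅ i ⁆ ≡ ⁅ j ⁆ → i ≡ j
⁅⁆-injective {i = i} {j} eq = x∈⁅y⁆⇒x≡y j (subst (i ∈_) eq (x∈⁅x⁆ i))

∁⁅⁆-injective : ∀ {n} {i j : Fin n} → ∁ ⁅ i ⁆ ≡ ∁ ⁅ j ⁆ → i ≡ j
∁⁅⁆-injective {i = i} {j} eq =
  x∈⁅y⁆⇒x≡y j (x∉∁p⇒x∈p (λ i∈∁⁅j⁆ → x∈p⇒x∉∁p (x∈⁅x⁆ i) (subst (i ∈_) (sym eq) i∈∁⁅j⁆)))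

⁅⁆≢⊥ : ∀ {n} {i : Fin n} → ⁅ i ⁆ ≢ ⊥
⁅⁆≢⊥ {i = i} eq = ∉⊥ (subst (i ∈_) eq (x∈⁅x⁆ i))

∁⁅⁆≢⊤ : ∀ {n} {i : Fin n} → ∁ ⁅ i ⁆ ≢ ⊤
∁⁅⁆≢⊤ {i = i} eq = x∈p⇒x∉∁p (x∈⁅x⁆ i) (subst (i ∈_) (sym eq) ∈⊤)

Pair : ℕ → Set
Pair n = Subset n × Subset n

_≟ₚ_ : ∀ {n} → DecidableEquality (Pair n)
_≟ₚ_ = Product.≡-dec (≡-dec Bool._≟_) (≡-dec Bool._≟_)

Below : ∀ {n} → Pair n → Pair n → Set
Below p q = Disjoint (proj₁ p) (proj₂ p) × p ⊑ q

below? : ∀ {n} (p q : Pair n) → Dec (Below p q)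
below? (B , B') (A , A') = disjoint? B B' ×-dec (B ⊆? A ×-dec A' ⊆? B')

_⊏_ : ∀ {n} → Rel (Pair n) _
_⊏_ = ×-Lex _≡_ _⊂_ _⊃_

⊏-wellFounded : ∀ {n} → WellFounded (_⊏_ {n})
⊏-wellFounded = ×-wellFounded ⊂-wellFounded ⊃-wellFounded

⊑∧≢⇒⊏ : ∀ {n} {p q : Pair n} → p ⊑ q → p ≢ q → p ⊏ q
⊑∧≢⇒⊏ {p = B , B'} {A , A'} (B⊆A , A'⊆B') p≢q with ≡-dec Bool._≟_ B A
... | yes refl = inj₂ (refl , ⊆∧≢⇒⊂ A'⊆B' (p≢q ∘ cong (B ,_) ∘ sym))
... | no  B≢A  = inj₁ (⊆∧≢⇒⊂ B⊆A B≢A)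

pointMass : ∀ {n} → Pair n → ℚ → Pair n → ℚ
pointMass p x q = if ⌊ q ≟ₚ p ⌋ then x else 0ℚ

pointMass-hit : ∀ {n} (p : Pair n) (x : ℚ) → pointMass p x p ≡ x
pointMass-hit p x = if-dec-yes (p ≟ₚ p) refl

pointMass-miss : ∀ {n} {p q : Pair n} (x : ℚ) → q ≢ p → pointMass p x q ≡ 0ℚ
pointMass-miss {p = p} {q} x q≢p = if-dec-no (q ≟ₚ p) q≢p

sumFin-pointMass-hit : ∀ {m n} (c : Fin m → Pair n) → (∀ {i j} → c i ≡ c j → i ≡ j)
  → (x : Fin m → ℚ) (i : Fin m) → sumFin (λ j → pointMass (c j) (x j) (c i)) ≡ x i
sumFin-pointMass-hit c c-injective x i =
  trans (sumFin-point _ i (λ j j≢i → pointMass-miss (x j) (j≢i ∘ sym ∘ c-injective)))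
        (pointMass-hit (c i) (x i))

sumFin-pointMass-miss : ∀ {m n} (c : Fin m → Pair n) (x : Fin m → ℚ) {q : Pair n}
  → (∀ j → q ≢ c j) → sumFin (λ j → pointMass (c j) (x j) q) ≡ 0ℚ
sumFin-pointMass-miss c x q∉c = sumFin-zero (λ j → pointMass-miss (x j) (q∉c j))

sumBelow-+ : ∀ {n} (f g : Subset n → Subset n → ℚ) A A'
  → sumBelow (λ B B' → f B B' + g B B') A A' ≡ sumBelow f A A' + sumBelow g A A'
sumBelow-+ {n} f g A A' =
  trans (sumSubsets-cong n λ B →
           trans (sumSubsets-cong n λ B' → if-+ ⌊ below? (B , B') (A , A') ⌋ (f B B') (g B B'))
                 (sumSubsets-+ n _ _))
        (sumSubsets-+ n _ _)

sumBelow-neg : ∀ {n} (f : Subset n → Subset n → ℚ) A A'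
  → sumBelow (λ B B' → - f B B') A A' ≡ - sumBelow f A A'
sumBelow-neg {n} f A A' =
  trans (sumSubsets-cong n λ B →
           trans (sumSubsets-cong n λ B' → sym (if-float -_ ⌊ below? (B , B') (A , A') ⌋))
                 (sumSubsets-neg n _))
        (sumSubsets-neg n _)

sumBelow-- : ∀ {n} (f g : Subset n → Subset n → ℚ) A A'
  → sumBelow (λ B B' → f B B' - g B B') A A' ≡ sumBelow f A A' - sumBelow g A A'
sumBelow-- f g A A' =
  trans (sumBelow-+ f (λ B B' → - g B B') A A') (cong (sumBelow f A A' +_) (sumBelow-neg g A A'))

sumBelow-sumFin : ∀ {n m} (h : Fin m → Subset n → Subset n → ℚ) A A'
  → sumBelow (λ B B' → sumFin (λ i → h i B B')) A A' ≡ sumFin (λ i → sumBelow (h i) A A')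
sumBelow-sumFin {n} {m} h A A' =
  trans (sumSubsets-cong n λ B →
           trans (sumSubsets-cong n λ B' → if-sumFin ⌊ below? (B , B') (A , A') ⌋ (λ i → h i B B'))
                 (sumSubsets-sumFin n {m} _))
        (sumSubsets-sumFin n {m} _)
  where
  if-sumFin : ∀ b (f : Fin m → ℚ) → (if b then sumFin f else 0ℚ) ≡ sumFin (λ i → if b then f i else 0ℚ)
  if-sumFin true  f = refl
  if-sumFin false f = sym (sumFin-zero {m} λ _ → refl)

sumBelow-pointMass : ∀ {n} (p : Pair n) (x : ℚ) A A'
  → sumBelow (curry (pointMass p x)) A A' ≡ (if ⌊ below? p (A , A') ⌋ then x else 0ℚ)
sumBelow-pointMass {n} p@(C , C') x A A' =
  trans (sumSubsets²-point n _ C C' off-p)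
        (cong (if ⌊ below? p (A , A') ⌋ then_else 0ℚ) (pointMass-hit p x))
  where
  off-p : ∀ B B' → (B , B') ≢ p → (if ⌊ below? (B , B') (A , A') ⌋ then pointMass p x (B , B') else 0ℚ) ≡ 0ℚ
  off-p B B' B,B'≢p = trans (cong (if ⌊ below? (B , B') (A , A') ⌋ then_else 0ℚ) (pointMass-miss x B,B'≢p))
                            (if-eta ⌊ below? (B , B') (A , A') ⌋)

sumBelow≡0⇒≡0 : ∀ {n} (d : Subset n → Subset n → ℚ)
  → (∀ A A' → Disjoint A A' → sumBelow d A A' ≡ 0ℚ)
  → ∀ A A' → Disjoint A A' → d A A' ≡ 0ℚ
sumBelow≡0⇒≡0 {n} d Σd≡0 A A' = go (⊏-wellFounded (A , A'))
  where
  open ≡-Reasoning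
  go : ∀ {A A'} → Acc _⊏_ (A , A') → Disjoint A A' → d A A' ≡ 0ℚ
  go {A} {A'} (acc rec) A∩A'≡⊥ = begin
    d A A'
      ≡⟨ if-dec-yes (below? (A , A') (A , A')) (A∩A'≡⊥ , ⊆-refl , ⊆-refl) ⟨
    (if ⌊ below? (A , A') (A , A') ⌋ then d A A' else 0ℚ)
      ≡⟨ sumSubsets²-point n _ A A' strictly-below ⟨
    sumBelow d A A'
      ≡⟨ Σd≡0 A A' A∩A'≡⊥ ⟩
    0ℚ ∎
    where
    strictly-below : ∀ B B' → (B , B') ≢ (A , A')
      → (if ⌊ below? (B , B') (A , A') ⌋ then d B B' else 0ℚ) ≡ 0ℚ
    strictly-below B B' B,B'≢A,A' with below? (B , B') (A , A')
    ... | yes (B∩B'≡⊥ , B,B'⊑A,A') = go (rec (⊑∧≢⇒⊏ B,B'⊑A,A' B,B'≢A,A')) B∩B'≡⊥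
    ... | no  _                     = refl

mobius-unique : ∀ {n} {v m m' : Subset n → Subset n → ℚ} → IsMobius v m → IsMobius v m'
  → ∀ A A' → Disjoint A A' → m A A' ≡ m' A A'
mobius-unique {v = v} {m} {m'} m-mobius m'-mobius A A' A∩A'≡⊥ =
  x∙y⁻¹≈ε⇒x≈y (m A A') (m' A A')
    (sumBelow≡0⇒≡0 (λ B B' → m B B' - m' B B') difference-vanishes A A' A∩A'≡⊥)
  where
  open ≡-Reasoning
  difference-vanishes : ∀ B B' → Disjoint B B' → sumBelow (λ C C' → m C C' - m' C C') B B' ≡ 0ℚ
  difference-vanishes B B' B∩B'≡⊥ = begin
    sumBelow (λ C C' → m C C' - m' C C') B B' ≡⟨ sumBelow-- m m' B B' ⟩
    sumBelow m B B' - sumBelow m' B B'        ≡⟨ cong₂ _-_ (m-mobius B B' B∩B'≡⊥) (m'-mobius B B' B∩B'≡⊥) ⟨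
    v B B' - v B B'                           ≡⟨ ℚ.+-inverseʳ (v B B') ⟩
    0ℚ                                        ∎

joinIrr⁺ : ∀ {n} → Fin n → Pair n
joinIrr⁺ i = ⁅ i ⁆ , ∁ ⁅ i ⁆

joinIrr⁻ : ∀ {n} → Fin n → Pair n
joinIrr⁻ i = ⊥ , ∁ ⁅ i ⁆

bottom : ∀ {n} → Pair n
bottom = ⊥ , ⊤

joinIrr⁺-injective : ∀ {n} {i j : Fin n} → joinIrr⁺ i ≡ joinIrr⁺ j → i ≡ j
joinIrr⁺-injective = ⁅⁆-injective ∘ cong proj₁

joinIrr⁻-injective : ∀ {n} {i j : Fin n} → joinIrr⁻ i ≡ joinIrr⁻ j → i ≡ j
joinIrr⁻-injective = ∁⁅⁆-injective ∘ cong proj₂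

joinIrr⁺≢joinIrr⁻ : ∀ {n} {i j : Fin n} → joinIrr⁺ i ≢ joinIrr⁻ j
joinIrr⁺≢joinIrr⁻ = ⁅⁆≢⊥ ∘ cong proj₁

joinIrr⁺≢bottom : ∀ {n} {i : Fin n} → joinIrr⁺ i ≢ bottom
joinIrr⁺≢bottom = ⁅⁆≢⊥ ∘ cong proj₁

joinIrr⁻≢bottom : ∀ {n} {i : Fin n} → joinIrr⁻ i ≢ bottom
joinIrr⁻≢bottom = ∁⁅⁆≢⊤ ∘ cong proj₂

joinIrr⁺-below⇔∈ : ∀ {n} {A A' : Subset n} → Disjoint A A' → (i : Fin n) → Below (joinIrr⁺ i) (A , A') ⇔ i ∈ A
joinIrr⁺-below⇔∈ {A = A} {A'} A∩A'≡⊥ i = mk⇔ (λ (_ , ⁅i⁆⊆A , _) → ⁅i⁆⊆A (x∈⁅x⁆ i)) below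
  where
  below : i ∈ A → Below (joinIrr⁺ i) (A , A')
  below i∈A = ∩-inverseʳ ⁅ i ⁆ , ⁅i⁆⊆A , A'⊆∁⁅i⁆
    where
    ⁅i⁆⊆A : ⁅ i ⁆ ⊆ A
    ⁅i⁆⊆A x∈⁅i⁆ = subst (_∈ A) (sym (x∈⁅y⁆⇒x≡y i x∈⁅i⁆)) i∈A
    A'⊆∁⁅i⁆ : A' ⊆ ∁ ⁅ i ⁆
    A'⊆∁⁅i⁆ {x} x∈A' = x∉p⇒x∈∁p λ x∈⁅i⁆ → ∉⊥ (subst (x ∈_) A∩A'≡⊥ (x∈p∩q⁺ (⁅i⁆⊆A x∈⁅i⁆ , x∈A')))

joinIrr⁻-below⇔∈∁ : ∀ {n} {A A' : Subset n} (i : Fin n) → Below (joinIrr⁻ i) (A , A') ⇔ i ∈ ∁ A'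
joinIrr⁻-below⇔∈∁ {A = A} {A'} i = mk⇔ (λ (_ , _ , A'⊆∁⁅i⁆) → x∉p⇒x∈∁p (x∈p⇒x∉∁p (x∈⁅x⁆ i) ∘ A'⊆∁⁅i⁆)) below
  where
  below : i ∈ ∁ A' → Below (joinIrr⁻ i) (A , A')
  below i∈∁A' = ∩-zeroˡ (∁ ⁅ i ⁆) , ⊥⊆ , λ x∈A' → x∉p⇒x∈∁p λ x∈⁅i⁆ →
    x∈∁p⇒x∉p i∈∁A' (subst (_∈ A') (x∈⁅y⁆⇒x≡y i x∈⁅i⁆) x∈A')

bottom-below : ∀ {n} (q : Pair n) → Below bottom q
bottom-below (A , A') = ∩-zeroˡ ⊤ , ⊥⊆ , ⊆⊤

additiveMobius : ∀ {n} (f₁ f₂ : Fin n → ℚ) → Pair n → ℚ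
additiveMobius f₁ f₂ q =
  sumFin (λ i → pointMass (joinIrr⁺ i) (f₁ i) q) + sumFin (λ i → pointMass (joinIrr⁻ i) (f₂ i) q)
    + pointMass bottom (- sumFin f₂) q

additiveMobius-joinIrr⁺ : ∀ {n} (f₁ f₂ : Fin n → ℚ) i → additiveMobius f₁ f₂ (joinIrr⁺ i) ≡ f₁ i
additiveMobius-joinIrr⁺ f₁ f₂ i =
  trans (cong₂ _+_ (cong₂ _+_ (sumFin-pointMass-hit joinIrr⁺ joinIrr⁺-injective f₁ i)
                              (sumFin-pointMass-miss joinIrr⁻ f₂ λ _ → joinIrr⁺≢joinIrr⁻))
                   (pointMass-miss (- sumFin f₂) (joinIrr⁺≢bottom {i = i})))
        (trans (ℚ.+-identityʳ _) (ℚ.+-identityʳ (f₁ i)))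

additiveMobius-joinIrr⁻ : ∀ {n} (f₁ f₂ : Fin n → ℚ) i → additiveMobius f₁ f₂ (joinIrr⁻ i) ≡ f₂ i
additiveMobius-joinIrr⁻ f₁ f₂ i =
  trans (cong₂ _+_ (cong₂ _+_ (sumFin-pointMass-miss joinIrr⁺ f₁ λ _ → ≢-sym joinIrr⁺≢joinIrr⁻)
                              (sumFin-pointMass-hit joinIrr⁻ joinIrr⁻-injective f₂ i))
                   (pointMass-miss (- sumFin f₂) (joinIrr⁻≢bottom {i = i})))
        (trans (ℚ.+-identityʳ _) (ℚ.+-identityˡ (f₂ i)))

additiveMobius-bottom : ∀ {n} (f₁ f₂ : Fin n → ℚ) → additiveMobius f₁ f₂ bottom ≡ - sumFin f₂
additiveMobius-bottom f₁ f₂ =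
  trans (cong₂ _+_ (cong₂ _+_ (sumFin-pointMass-miss joinIrr⁺ f₁ λ _ → ≢-sym joinIrr⁺≢bottom)
                              (sumFin-pointMass-miss joinIrr⁻ f₂ λ _ → ≢-sym joinIrr⁻≢bottom))
                   (pointMass-hit bottom (- sumFin f₂)))
        (ℚ.+-identityˡ (- sumFin f₂))

additiveMobius-elsewhere : ∀ {n} (f₁ f₂ : Fin n → ℚ) {q : Pair n}
  → (∀ i → q ≢ joinIrr⁺ i) → (∀ i → q ≢ joinIrr⁻ i) → q ≢ bottom
  → additiveMobius f₁ f₂ q ≡ 0ℚ
additiveMobius-elsewhere f₁ f₂ q≢joinIrr⁺ q≢joinIrr⁻ q≢bottom =
  cong₂ _+_ (cong₂ _+_ (sumFin-pointMass-miss joinIrr⁺ f₁ q≢joinIrr⁺)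
                       (sumFin-pointMass-miss joinIrr⁻ f₂ q≢joinIrr⁻))
            (pointMass-miss (- sumFin f₂) q≢bottom)

sumBelow-additiveMobius : ∀ {n} (f₁ f₂ : Fin n → ℚ) A A' → Disjoint A A'
  → sumBelow (curry (additiveMobius f₁ f₂)) A A' ≡ sumIn A f₁ - sumIn A' f₂
sumBelow-additiveMobius f₁ f₂ A A' A∩A'≡⊥ = begin
  sumBelow (curry (additiveMobius f₁ f₂)) A A'
    ≡⟨ sumBelow-+ (λ B B' → Σ⁺ B B' + Σ⁻ B B') (curry (pointMass bottom (- sumFin f₂))) A A' ⟩
  sumBelow (λ B B' → Σ⁺ B B' + Σ⁻ B B') A A' + sumBelow (curry (pointMass bottom (- sumFin f₂))) A A'
    ≡⟨ cong₂ _+_ (sumBelow-+ Σ⁺ Σ⁻ A A') (sumBelow-pointMass bottom (- sumFin f₂) A A') ⟩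
  sumBelow Σ⁺ A A' + sumBelow Σ⁻ A A' + (if ⌊ below? bottom (A , A') ⌋ then - sumFin f₂ else 0ℚ)
    ≡⟨ cong₂ _+_ (cong₂ _+_ positive negative) (if-dec-yes (below? bottom (A , A')) (bottom-below (A , A'))) ⟩
  sumIn A f₁ + sumIn (∁ A') f₂ + - sumFin f₂
    ≡⟨ cong (λ total → sumIn A f₁ + sumIn (∁ A') f₂ + - total) (sumIn-∁ A' f₂) ⟨
  sumIn A f₁ + sumIn (∁ A') f₂ + - (sumIn A' f₂ + sumIn (∁ A') f₂)
    ≡⟨ solve 3 (λ a b c → a :+ c :+ :- (b :+ c) := a :+ :- b) refl (sumIn A f₁) (sumIn A' f₂) (sumIn (∁ A') f₂) ⟩
  sumIn A f₁ - sumIn A' f₂ ∎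
  where
  open ≡-Reasoning
  Σ⁺ Σ⁻ : _ → _ → ℚ
  Σ⁺ B B' = sumFin (λ i → pointMass (joinIrr⁺ i) (f₁ i) (B , B'))
  Σ⁻ B B' = sumFin (λ i → pointMass (joinIrr⁻ i) (f₂ i) (B , B'))
  positive : sumBelow Σ⁺ A A' ≡ sumIn A f₁
  positive = trans (sumBelow-sumFin (λ i → curry (pointMass (joinIrr⁺ i) (f₁ i))) A A')
    (sumFin-cong λ i → trans (sumBelow-pointMass (joinIrr⁺ i) (f₁ i) A A')
                             (if-dec-⇔ (below? _ _) (i ∈? A) (joinIrr⁺-below⇔∈ A∩A'≡⊥ i)))
  negative : sumBelow Σ⁻ A A' ≡ sumIn (∁ A') f₂
  negative = trans (sumBelow-sumFin (λ i → curry (pointMass (joinIrr⁻ i) (f₂ i))) A A')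
    (sumFin-cong λ i → trans (sumBelow-pointMass (joinIrr⁻ i) (f₂ i) A A')
                             (if-dec-⇔ (below? _ _) (i ∈? ∁ A') (joinIrr⁻-below⇔∈∁ i)))

proposition2 : (n : ℕ) (ν₁ ν₂ : Subset n → ℚ)
    → IsNormalizedCapacity ν₁ → IsAdditive ν₁
    → IsNormalizedCapacity ν₂ → IsAdditive ν₂
    → (v : Subset n → Subset n → ℚ)
    → (∀ A B → Disjoint A B → v A B ≡ sumIn A (λ i → ν₁ ⁅ i ⁆) - sumIn B (λ i → ν₂ ⁅ i ⁆))
    → (m : Subset n → Subset n → ℚ)
    → IsMobius v m
    → ((i : Fin n) → m ⁅ i ⁆ (∁ ⁅ i ⁆) ≡ ν₁ ⁅ i ⁆)
      × ((i : Fin n) → m ⊥ (∁ ⁅ i ⁆) ≡ ν₂ ⁅ i ⁆)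
      × m ⊥ ⊤ ≡ - 1ℚ
      × (∀ A B → Disjoint A B
           → (∀ i → ¬ ((A , B) ≡ (⁅ i ⁆ , ∁ ⁅ i ⁆)))
           → (∀ i → ¬ ((A , B) ≡ (⊥ , ∁ ⁅ i ⁆)))
           → ¬ ((A , B) ≡ (⊥ , ⊤))
           → m A B ≡ 0ℚ)
proposition2 n ν₁ ν₂ _ _ ν₂-capacity ν₂-additive v v-additive m m-mobius =
    (λ i → trans (m≡M (joinIrr⁺ i) (∩-inverseʳ ⁅ i ⁆)) (additiveMobius-joinIrr⁺ f₁ f₂ i))
  , (λ i → trans (m≡M (joinIrr⁻ i) (∩-zeroˡ (∁ ⁅ i ⁆))) (additiveMobius-joinIrr⁻ f₁ f₂ i))
  , trans (m≡M bottom (∩-zeroˡ ⊤)) (trans (additiveMobius-bottom f₁ f₂) (cong -_ f₂-total))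
  , λ A B A∩B≡⊥ ≢joinIrr⁺ ≢joinIrr⁻ ≢bottom →
      trans (m≡M (A , B) A∩B≡⊥) (additiveMobius-elsewhere f₁ f₂ ≢joinIrr⁺ ≢joinIrr⁻ ≢bottom)
  where
  f₁ f₂ : Fin n → ℚ
  f₁ i = ν₁ ⁅ i ⁆
  f₂ i = ν₂ ⁅ i ⁆
  f₂-total : sumFin f₂ ≡ 1ℚ
  f₂-total = trans (sym (sumIn-⊤ f₂)) (trans (sym (ν₂-additive ⊤)) (IsNormalizedCapacity.full ν₂-capacity))
  M-mobius : IsMobius v (curry (additiveMobius f₁ f₂))
  M-mobius A A' A∩A'≡⊥ = trans (v-additive A A' A∩A'≡⊥) (sym (sumBelow-additiveMobius f₁ f₂ A A' A∩A'≡⊥))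
  m≡M : ∀ q → Disjoint (proj₁ q) (proj₂ q) → m (proj₁ q) (proj₂ q) ≡ additiveMobius f₁ f₂ q
  m≡M (A , A') = mobius-unique m-mobius M-mobius A A'
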